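{- Let $G$ be a graph with source $s$, let $T$ be any spanning tree of $G$, and let $(B_1,\dots,B_k)$ be a barrier sequence for $T$. Then $$\log(\mathrm{Lin}(G))\ge\log(\mathrm{Lin}(T))=\Omega\Big(\sum_{i=1}^k|B_i|\log|B_i|\Big).$$
   Context: $G$ is directed or undirected; undirected graphs are connected, in directed graphs every vertex is reachable from $s$. A spanning tree is rooted at $s$ (in directed graphs with edges directed away from $s$). For a rooted tree $T$, a linearization is a linear order of $V(T)$ in which no vertex precedes one of its ancestors; $\mathrm{Lin}(T)$ is the number of linearizations of $T$; a linearization of $G$ is a linearization of some spanning tree of $G$ and $\mathrm{Lin}(G)$ is their number. A barrier is a set $B\subseteq V(T)$ containing no two vertices one of which is an ancestor of the other. For disjoint barriers, $B_1\prec B_2$ means no node of $B_2$ is an ancestor of a node of $B_1$. A barrier sequence is a sequence $(B_1,\dots,B_k)$ of pairwise disjoint barriers with $B_i\prec B_j$ whenever $i<j$. Logarithms base 2, with $0\log 0=0$. -}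

module Defs where

open import Data.Nat using (ℕ; zero; suc; _*_; _^_)
open import Data.Fin using (Fin; zero; suc; _<_)
open import Data.Fin.Subset using (Subset; _∈_; ∣_∣)
open import Data.List using (List; length; lookup)
open import Data.List.Relation.Unary.Unique.Propositional using (Unique)
import Data.List.Membership.Propositional as LM
open import Data.Product using (Σ; _×_; ∃-syntax)
open import Relation.Binary.PropositionalEquality using (_≡_; _≢_)
open import Relation.Binary.Construct.Closure.ReflexiveTransitive using (Star)
open import Relation.Nullary using (¬_)
open import Data.Empty using (⊥)

-- A (directed) graph on vertex set Fin n: an edge relation.
-- Undirected graphs are the special case of a symmetric relation.
Graph : ℕ → Set₁
Graph n = Fin n → Fin n → Set

AllReachable : ∀ {n} → Graph n → Fin n → Set
AllReachable {n} E s = ∀ (v : Fin n) → Star E s v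

iter : ∀ {A : Set} → (A → A) → ℕ → A → A
iter f zero    x = x
iter f (suc k) x = f (iter f k x)

record SpanningTree {n : ℕ} (E : Graph n) (s : Fin n) : Set where
  field
    parent      : Fin n → Fin n
    parent-root : parent s ≡ s
    parent-edge : ∀ v → v ≢ s → E (parent v) v
    rooted      : ∀ v → ∃[ k ] iter parent k v ≡ s

open SpanningTree public

-- u is an ancestor of v in T (reflexive: v is an ancestor of itself)
Ancestor : ∀ {n} {E : Graph n} {s : Fin n} → SpanningTree E s → Fin n → Fin n → Set
Ancestor T u v = ∃[ k ] iter (parent T) k v ≡ u

ProperAncestor : ∀ {n} {E : Graph n} {s : Fin n} → SpanningTree E s → Fin n → Fin n → Set
ProperAncestor T u v = (u ≢ v) × Ancestor T u v

IsLinearOrder : ∀ {n} → List (Fin n) → Set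
IsLinearOrder {n} xs = Unique xs × (∀ (v : Fin n) → v LM.∈ xs)

IsLinearization : ∀ {n} {E : Graph n} {s : Fin n} → SpanningTree E s → List (Fin n) → Set
IsLinearization T xs =
  IsLinearOrder xs ×
  (∀ (i j : Fin (length xs)) → i < j → ¬ ProperAncestor T (lookup xs j) (lookup xs i))

IsLinearizationG : ∀ {n} → Graph n → Fin n → List (Fin n) → Set
IsLinearizationG E s xs = Σ (SpanningTree E s) λ T → IsLinearization T xs

HasCount : {A : Set} → (A → Set) → ℕ → Set
HasCount {A} P m =
  Σ (List A) λ L → Unique L × (∀ x → x LM.∈ L → P x) × (∀ x → P x → x LM.∈ L) × length L ≡ m

LinT≡ : ∀ {n} {E : Graph n} {s : Fin n} → SpanningTree E s → ℕ → Set
LinT≡ T m = HasCount (IsLinearization T) m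

LinG≡ : ∀ {n} → Graph n → Fin n → ℕ → Set
LinG≡ E s m = HasCount (IsLinearizationG E s) m

IsBarrier : ∀ {n} {E : Graph n} {s : Fin n} → SpanningTree E s → Subset n → Set
IsBarrier T B = ∀ u v → u ∈ B → v ∈ B → u ≢ v → ¬ Ancestor T u v

Precedes : ∀ {n} {E : Graph n} {s : Fin n} → SpanningTree E s → Subset n → Subset n → Set
Precedes T B₁ B₂ = ∀ u w → u ∈ B₂ → w ∈ B₁ → ¬ Ancestor T u w

IsBarrierSequence : ∀ {n} {E : Graph n} {s : Fin n} → SpanningTree E s →
                    (k : ℕ) → (Fin k → Subset n) → Set
IsBarrierSequence {n} T k B =
  (∀ i → IsBarrier T (B i)) ×
  (∀ i j → i ≢ j → ∀ (v : Fin n) → v ∈ B i → v ∈ B j → ⊥) ×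
  (∀ i j → i < j → Precedes T (B i) (B j))

prodFin : (k : ℕ) → (Fin k → ℕ) → ℕ
prodFin zero    f = 1
prodFin (suc k) f = f zero * prodFin k (λ i → f (suc i))

-- ∏ᵢ |Bᵢ|^|Bᵢ|  ( = 2^(Σ |Bᵢ| log |Bᵢ|), with 0^0 = 1 )
barrierWeight : ∀ {n} (k : ℕ) → (Fin k → Subset n) → ℕ
barrierWeight k B = prodFin k (λ i → ∣ B i ∣ ^ ∣ B i ∣)

{-# OPTIONS --safe #-}
module Submission where

-- Every linearization of T is one of G, so Lin(T) ≤ Lin(G). For the barrier bound, rank each
-- vertex v by the pair (index of the first barrier containing a descendant of v, depth of v),
-- with barrier vertices moved to the end of their block. Ancestors then have strictly smaller
-- rank and each Bᵢ lies in one rank class, so listing the rank classes in increasing order, each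
-- in an arbitrary order, yields ∏ₜ |class t|! ≥ ∏ᵢ |Bᵢ|! distinct linearizations of T.
-- Finally b^b ≤ (b!)², since (b!)² = ∏ᵢ (i + 1)(b − i) and every factor is at least b.

open import Defs
open import Data.Nat using (ℕ; zero; suc; _+_; _*_; _∸_; _^_; _≤_; _<_; z≤n; s≤s; s≤s⁻¹; NonZero; >-nonZero; _!)
open import Data.Nat.Properties
open import Data.Nat.Combinatorics.Base using (_P′_)
open import Data.Nat.Combinatorics.Specification using (nP′n≡n!)
open import Data.Nat.Divisibility using (∣⇒≤; m≤n⇒m!∣n!)
open import Data.Nat.Solver using (module +-*-Solver)
open import Data.Bool using (if_then_else_)
open import Data.List using (List; []; _∷_; _++_; [_]; length; map; concatMap; filter; allFin; tabulate; lookup)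
open import Data.List.Properties using (length-++; length-map; ∷-injective; ∷-injectiveˡ; ∷-injectiveʳ; ++-cancelˡ)
open import Data.List.Extrema.Nat using (max; xs≤max)
open import Data.List.Membership.Propositional using (_∈_; _∉_; find)
open import Data.List.Membership.Propositional.Properties
  using (∈-∃++; ∈-lookup; ∈-++⁻; ∈-++⁺ˡ; ∈-++⁺ʳ; ∈-map⁺; ∈-map⁻; ∈-concatMap⁻; ∈-filter⁺; ∈-filter⁻; ∈-allFin)
open import Data.List.Relation.Binary.Subset.Propositional using (_⊆_)
open import Data.List.Relation.Binary.Disjoint.Propositional using (Disjoint)
open import Data.List.Relation.Unary.Any using (here; there)
import Data.List.Relation.Unary.All as All
open import Data.List.Relation.Unary.AllPairs as AllPairs using (AllPairs)
import Data.List.Relation.Unary.AllPairs.Properties as AllPairsₚ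
open import Data.List.Relation.Unary.Unique.Propositional using (Unique; []; _∷_)
import Data.List.Relation.Unary.Unique.Propositional.Properties as Uniqueₚ
open import Data.List.Relation.Binary.Permutation.Propositional using (_↭_; ↭-sym; ↭-trans; ↭-prep; ↭-reflexive; ↭⇒↭ₛ)
open import Data.List.Relation.Binary.Permutation.Propositional.Properties using (∈-resp-↭; ↭-length; shift)
import Data.List.Relation.Binary.Permutation.Setoid.Properties as Permutationₛ
open import Data.Fin using (Fin; zero; suc; toℕ) renaming (_<_ to _<ᶠ_)
import Data.Fin.Properties as Finₚ
open import Data.Fin.Subset using (Subset; inside; outside; ∣_∣) renaming (_∈_ to _∈ₛ_)
open import Data.Fin.Subset.Properties using (_∈?_)
import Data.Vec as Vec
open import Data.Product using (_×_; _,_; proj₁; proj₂; ∃-syntax; ∃₂)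
open import Data.Sum using (inj₁; inj₂)
open import Function using (_∘_; id)
open import Relation.Nullary using (Dec; yes; no; does; ¬_; contradiction)
open import Relation.Nullary.Decidable as Dec using (_×-dec_)
open import Relation.Binary.PropositionalEquality
  using (_≡_; _≢_; refl; sym; trans; cong; cong₂; subst; setoid; module ≡-Reasoning)

private
  variable
    A B : Set
    x : A
    xs ys zs : List A

Unique-resp-↭ : {A : Set} {xs ys : List A} → xs ↭ ys → Unique xs → Unique ys
Unique-resp-↭ {A} p = Permutationₛ.Unique-resp-↭ (setoid A) (↭⇒↭ₛ p)

Unique⇒length≤ : Unique xs → xs ⊆ ys → length xs ≤ length ys
Unique⇒length≤ [] _ = z≤n
Unique⇒length≤ {xs = x ∷ xs} (x∉xs ∷ !xs) xs⊆ys with ∈-∃++ (xs⊆ys (here refl))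
... | as , bs , refl = begin
  suc (length xs)            ≤⟨ s≤s (Unique⇒length≤ !xs xs⊆as++bs) ⟩
  suc (length (as ++ bs))    ≡⟨ ↭-length (↭-sym (shift x as bs)) ⟩
  length (as ++ [ x ] ++ bs) ∎
  where
  open ≤-Reasoning
  xs⊆as++bs : xs ⊆ as ++ bs
  xs⊆as++bs z∈xs with ∈-resp-↭ (shift x as bs) (xs⊆ys (there z∈xs))
  ... | here refl = contradiction refl (All.lookup x∉xs z∈xs)
  ... | there z∈as++bs = z∈as++bs

∈-concatMap⇒∃ : (f : A → List B) {y : B} → y ∈ concatMap f xs → ∃[ x ] x ∈ xs × y ∈ f x
∈-concatMap⇒∃ f y∈ = find (∈-concatMap⁻ f y∈)

length-concatMap-const : (f : A → List B) {c : ℕ} → (∀ {x} → x ∈ xs → length (f x) ≡ c) →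
                         length (concatMap f xs) ≡ length xs * c
length-concatMap-const {xs = []} f _ = refl
length-concatMap-const {xs = x ∷ xs} f ≡c =
  trans (length-++ (f x)) (cong₂ _+_ (≡c (here refl)) (length-concatMap-const f (≡c ∘ there)))

Unique-concatMap : (f : A → List B) → Unique xs → (∀ {x} → x ∈ xs → Unique (f x)) →
                   (∀ {x y} → x ∈ xs → y ∈ xs → x ≢ y → Disjoint (f x) (f y)) →
                   Unique (concatMap f xs)
Unique-concatMap {xs = []} f _ _ _ = []
Unique-concatMap {xs = x ∷ xs} f (x∉xs ∷ !xs) !f disj =
  Uniqueₚ.++⁺ (!f (here refl)) (Unique-concatMap f !xs (!f ∘ there) (λ p q → disj (there p) (there q)))
    λ (z∈fx , z∈rest) → let y , y∈xs , z∈fy = ∈-concatMap⇒∃ f z∈rest in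
      disj (here refl) (there y∈xs) (All.lookup x∉xs y∈xs) (z∈fx , z∈fy)

insertions : A → List A → List (List A)
insertions x []       = [ [ x ] ]
insertions x (y ∷ ys) = (x ∷ y ∷ ys) ∷ map (y ∷_) (insertions x ys)

permutations : List A → List (List A)
permutations []       = [ [] ]
permutations (x ∷ xs) = concatMap (insertions x) (permutations xs)

∈-insertions⇒split : zs ∈ insertions x ys → ∃₂ λ as bs → ys ≡ as ++ bs × zs ≡ as ++ x ∷ bs
∈-insertions⇒split {ys = []}     (here refl) = [] , [] , refl , refl
∈-insertions⇒split {ys = y ∷ ys} (here refl) = [] , y ∷ ys , refl , refl
∈-insertions⇒split {ys = y ∷ ys} (there zs∈) with ∈-map⁻ (y ∷_) zs∈
... | ws , ws∈ , refl with ∈-insertions⇒split ws∈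
... | as , bs , refl , refl = y ∷ as , bs , refl , refl

∈-insertions⇒↭ : zs ∈ insertions x ys → zs ↭ x ∷ ys
∈-insertions⇒↭ {x = x} zs∈ with ∈-insertions⇒split zs∈
... | as , bs , refl , refl = shift x as bs

length-insertions : (x : A) (ys : List A) → length (insertions x ys) ≡ suc (length ys)
length-insertions x []       = refl
length-insertions x (y ∷ ys) = cong suc (trans (length-map (y ∷_) (insertions x ys)) (length-insertions x ys))

∈-permutations⇒↭ : zs ∈ permutations xs → zs ↭ xs
∈-permutations⇒↭ {xs = []}     (here refl) = ↭-reflexive refl
∈-permutations⇒↭ {xs = x ∷ xs} zs∈ with ∈-concatMap⇒∃ (insertions x) zs∈
... | ys , ys∈ , zs∈ins = ↭-trans (∈-insertions⇒↭ zs∈ins) (↭-prep x (∈-permutations⇒↭ ys∈))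

length-permutations : (xs : List A) → length (permutations xs) ≡ length xs !
length-permutations []       = refl
length-permutations (x ∷ xs) = begin
  length (concatMap (insertions x) (permutations xs)) ≡⟨ length-concatMap-const (insertions x) length-ins ⟩
  length (permutations xs) * suc (length xs)          ≡⟨ cong (_* suc (length xs)) (length-permutations xs) ⟩
  length xs ! * suc (length xs)                       ≡⟨ *-comm (length xs !) (suc (length xs)) ⟩
  suc (length xs) !                                   ∎
  where
  open ≡-Reasoning
  length-ins : ∀ {ys} → ys ∈ permutations xs → length (insertions x ys) ≡ suc (length xs)
  length-ins {ys} ys∈ = trans (length-insertions x ys) (cong suc (↭-length (∈-permutations⇒↭ {xs = xs} ys∈)))

Unique-insertions : x ∉ ys → Unique (insertions x ys)
Unique-insertions {ys = []}     _    = All.[] ∷ []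
Unique-insertions {x = x} {ys = y ∷ ys} x∉ =
  All.tabulate head≢ ∷ Uniqueₚ.map⁺ ∷-injectiveʳ (Unique-insertions (x∉ ∘ there))
  where
  head≢ : ∀ {ws} → ws ∈ map (y ∷_) (insertions x ys) → x ∷ y ∷ ys ≢ ws
  head≢ ws∈ eq with ∈-map⁻ (y ∷_) ws∈
  ... | _ , _ , refl = x∉ (here (∷-injectiveˡ eq))

++-∷-cancel-∉ : ∀ (as as′ : List A) {bs bs′} → x ∉ as → x ∉ as′ →
                as ++ x ∷ bs ≡ as′ ++ x ∷ bs′ → as ++ bs ≡ as′ ++ bs′
++-∷-cancel-∉ []       []        _  _   eq = ∷-injectiveʳ eq
++-∷-cancel-∉ []       (a ∷ as′) _  x∉′ eq = contradiction (here (∷-injectiveˡ eq)) x∉′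
++-∷-cancel-∉ (a ∷ as) []        x∉ _   eq = contradiction (here (sym (∷-injectiveˡ eq))) x∉
++-∷-cancel-∉ (a ∷ as) (a′ ∷ as′) x∉ x∉′ eq with ∷-injective eq
... | refl , eq′ = cong (a ∷_) (++-∷-cancel-∉ as as′ (x∉ ∘ there) (x∉′ ∘ there) eq′)

insertions-disjoint : x ∉ ys → x ∉ zs → ys ≢ zs → Disjoint (insertions x ys) (insertions x zs)
insertions-disjoint x∉ys x∉zs ys≢zs (ws∈ , ws∈′) with ∈-insertions⇒split ws∈ | ∈-insertions⇒split ws∈′
... | as , bs , refl , refl | as′ , bs′ , refl , eq =
  ys≢zs (++-∷-cancel-∉ as as′ (x∉ys ∘ ∈-++⁺ˡ) (x∉zs ∘ ∈-++⁺ˡ) eq)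

Unique-permutations : Unique xs → Unique (permutations xs)
Unique-permutations []                    = All.[] ∷ []
Unique-permutations {xs = x ∷ xs} (x∉xs ∷ !xs) =
  Unique-concatMap (insertions x) (Unique-permutations !xs)
    (Unique-insertions ∘ x∉)
    (λ ys∈ zs∈ → insertions-disjoint (x∉ ys∈) (x∉ zs∈))
  where
  x∉ : ∀ {ys} → ys ∈ permutations xs → x ∉ ys
  x∉ ys∈ x∈ys = All.lookup x∉xs (∈-resp-↭ (∈-permutations⇒↭ ys∈) x∈ys) refl

AllPairs-lookup : {R : A → A → Set} → AllPairs R xs → ∀ {i j} → i <ᶠ j → R (lookup xs i) (lookup xs j)
AllPairs-lookup (Rx AllPairs.∷ _)  {zero}  {suc j} _         = All.lookup Rx (∈-lookup j)
AllPairs-lookup (_ AllPairs.∷ Rxs) {suc i} {suc j} (s≤s i<j) = AllPairs-lookup Rxs i<j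

++-injectiveˡ-length : {A : Set} (as as′ : List A) {bs bs′ : List A} →
                       length as ≡ length as′ → as ++ bs ≡ as′ ++ bs′ → as ≡ as′
++-injectiveˡ-length []       []        _   _  = refl
++-injectiveˡ-length (a ∷ as) (a′ ∷ as′) len eq with ∷-injective eq
... | refl , eq′ = cong (a ∷_) (++-injectiveˡ-length as as′ (suc-injective len) eq′)

prodFrom : (ℕ → ℕ) → ℕ → ℕ → ℕ
prodFrom w t zero    = 1
prodFrom w t (suc m) = w t * prodFrom w (suc t) m

prodFrom-+ : ∀ w t a b → prodFrom w t (a + b) ≡ prodFrom w t a * prodFrom w (t + a) b
prodFrom-+ w t zero    b rewrite +-identityʳ t = sym (+-identityʳ (prodFrom w t b))
prodFrom-+ w t (suc a) b rewrite prodFrom-+ w (suc t) a b | +-suc t a =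
  sym (*-assoc (w t) (prodFrom w (suc t) a) (prodFrom w (suc (t + a)) b))

module _ (w : ℕ → ℕ) (w≢0 : ∀ j → NonZero (w j)) where

  prodFrom≢0 : ∀ t m → NonZero (prodFrom w t m)
  prodFrom≢0 t zero    = _
  prodFrom≢0 t (suc m) = m*n≢0 (w t) _ {{w≢0 t}} {{prodFrom≢0 (suc t) m}}

  prodFrom-extend : ∀ t a b → prodFrom w t a ≤ prodFrom w t (a + b)
  prodFrom-extend t a b rewrite prodFrom-+ w t a b =
    m≤m*n (prodFrom w t a) (prodFrom w (t + a) b) {{prodFrom≢0 (t + a) b}}

  factor≤prodFrom : ∀ t {o m} → o < m → w (t + o) ≤ prodFrom w t m
  factor≤prodFrom t {zero} {suc m} _ rewrite +-identityʳ t =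
    m≤m*n (w t) (prodFrom w (suc t) m) {{prodFrom≢0 (suc t) m}}
  factor≤prodFrom t {suc o} {suc m} (s≤s o<m) rewrite +-suc t o =
    m≤n⇒m≤o*n (w t) {{w≢0 t}} (factor≤prodFrom (suc t) o<m)

  prodFin≤prodFrom : ∀ {N o} → o < N → ∀ k t (f : Fin k → ℕ) →
                     (∀ i → f i ≤ w (t + toℕ i * N + o)) → prodFin k f ≤ prodFrom w t (k * N)
  prodFin≤prodFrom o<N zero    t f f≤ = ≤-refl
  prodFin≤prodFrom {N} {o} o<N (suc k) t f f≤ = begin
    f zero * prodFin k (f ∘ suc)                 ≤⟨ *-mono-≤ first rest ⟩
    prodFrom w t N * prodFrom w (t + N) (k * N)  ≡⟨ sym (prodFrom-+ w t N (k * N)) ⟩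
    prodFrom w t (N + k * N)                     ∎
    where
    open ≤-Reasoning
    first : f zero ≤ prodFrom w t N
    first = ≤-trans (f≤ zero)
      (subst (λ j → w (j + o) ≤ prodFrom w t N) (sym (+-identityʳ t)) (factor≤prodFrom t o<N))
    rest : prodFin k (f ∘ suc) ≤ prodFrom w (t + N) (k * N)
    rest = prodFin≤prodFrom o<N k (t + N) (f ∘ suc)
      (λ i → subst (λ j → f (suc i) ≤ w (j + o)) (sym (+-assoc t N (toℕ i * N))) (f≤ (suc i)))

prodFin-mono-≤ : ∀ k {f g : Fin k → ℕ} → (∀ i → f i ≤ g i) → prodFin k f ≤ prodFin k g
prodFin-mono-≤ zero    f≤g = ≤-refl
prodFin-mono-≤ (suc k) f≤g = *-mono-≤ (f≤g zero) (prodFin-mono-≤ k (λ i → f≤g (suc i)))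

prodFin-square : ∀ k (f : Fin k → ℕ) → prodFin k (λ i → f i * f i) ≡ prodFin k f * prodFin k f
prodFin-square zero    f = refl
prodFin-square (suc k) f rewrite prodFin-square k (λ i → f (suc i)) =
  solve 2 (λ a p → (a :* a) :* (p :* p) := (a :* p) :* (a :* p)) refl (f zero) (prodFin k (λ i → f (suc i)))
  where open +-*-Solver

-- Each step multiplies the left side by b and the right side by (k + 1)(b ∸ k) ≥ b.
^≤!*P′ : ∀ b k → k ≤ b → b ^ k ≤ k ! * (b P′ k)
^≤!*P′ b zero    _   = ≤-refl
^≤!*P′ b (suc k) k<b = begin
  b * b ^ k                             ≤⟨ *-mono-≤ b≤ (^≤!*P′ b k (<⇒≤ k<b)) ⟩
  (suc k * (b ∸ k)) * (k ! * (b P′ k))  ≡⟨ solve 4 (λ a c f p → (a :* c) :* (f :* p) := (a :* f) :* (c :* p))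
                                                 refl (suc k) (b ∸ k) (k !) (b P′ k) ⟩
  (suc k * k !) * ((b ∸ k) * (b P′ k))  ∎
  where
  open ≤-Reasoning
  open +-*-Solver
  b≤ : b ≤ suc k * (b ∸ k)
  b≤ = begin
    b                      ≡⟨ sym (m+[n∸m]≡n (<⇒≤ k<b)) ⟩
    k + (b ∸ k)            ≤⟨ +-monoˡ-≤ (b ∸ k) (m≤m*n k (b ∸ k) {{>-nonZero (m<n⇒0<n∸m k<b)}}) ⟩
    k * (b ∸ k) + (b ∸ k)  ≡⟨ +-comm (k * (b ∸ k)) (b ∸ k) ⟩
    suc k * (b ∸ k)        ∎

^-self≤!*! : ∀ b → b ^ b ≤ b ! * b !
^-self≤!*! b = subst (λ x → b ^ b ≤ b ! * x) (nP′n≡n! b) (^≤!*P′ b b ≤-refl)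

∣p∣≤length-filter-tabulate : {A : Set} {P : A → Set} (P? : ∀ x → Dec (P x)) {n : ℕ} (f : Fin n → A) (p : Subset n) →
                             (∀ {i} → i ∈ₛ p → P (f i)) → ∣ p ∣ ≤ length (filter P? (tabulate f))
∣p∣≤length-filter-tabulate P? f Vec.[]            _   = z≤n
∣p∣≤length-filter-tabulate P? f (inside Vec.∷ p)  p⇒P with P? (f zero)
... | yes _ = s≤s (∣p∣≤length-filter-tabulate P? (f ∘ suc) p (p⇒P ∘ Vec.there))
... | no ¬P = contradiction (p⇒P Vec.here) ¬P
∣p∣≤length-filter-tabulate P? f (outside Vec.∷ p) p⇒P with P? (f zero)
... | yes _ = m≤n⇒m≤1+n (∣p∣≤length-filter-tabulate P? (f ∘ suc) p (p⇒P ∘ Vec.there))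
... | no _  = ∣p∣≤length-filter-tabulate P? (f ∘ suc) p (p⇒P ∘ Vec.there)

module Layers {n : ℕ} (rank : Fin n → ℕ) where

  layer : ℕ → List (Fin n)
  layer t = filter (λ v → rank v ≟ t) (allFin n)

  ∈-layer⁺ : ∀ {t v} → rank v ≡ t → v ∈ layer t
  ∈-layer⁺ {t} {v} = ∈-filter⁺ (λ v → rank v ≟ t) (∈-allFin v)

  ∈-layer⁻ : ∀ {t v} → v ∈ layer t → rank v ≡ t
  ∈-layer⁻ {t} = proj₂ ∘ ∈-filter⁻ (λ v → rank v ≟ t) {xs = allFin n}

  Unique-layer : ∀ t → Unique (layer t)
  Unique-layer t = Uniqueₚ.filter⁺ (λ v → rank v ≟ t) (Uniqueₚ.allFin⁺ n)

  ∣p∣≤length-layer : ∀ {t} (p : Subset n) → (∀ {v} → v ∈ₛ p → rank v ≡ t) → ∣ p ∣ ≤ length (layer t)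
  ∣p∣≤length-layer {t} p = ∣p∣≤length-filter-tabulate (λ v → rank v ≟ t) id p

  ∈-permutations-layer⁻ : ∀ {t π v} → π ∈ permutations (layer t) → v ∈ π → rank v ≡ t
  ∈-permutations-layer⁻ π∈ = ∈-layer⁻ ∘ ∈-resp-↭ (∈-permutations⇒↭ π∈)

  arrangements : ℕ → ℕ → List (List (Fin n))
  arrangements t zero    = [ [] ]
  arrangements t (suc m) = concatMap (λ π → map (π ++_) (arrangements (suc t) m)) (permutations (layer t))

  layerWeight : ℕ → ℕ
  layerWeight t = length (layer t) !

  length-arrangements : ∀ t m → length (arrangements t m) ≡ prodFrom layerWeight t m
  length-arrangements t zero    = refl
  length-arrangements t (suc m) = begin
    length (concatMap (λ π → map (π ++_) rest) (permutations (layer t)))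
      ≡⟨ length-concatMap-const {xs = permutations (layer t)} _ (λ {π} _ → length-map (π ++_) rest) ⟩
    length (permutations (layer t)) * length rest
      ≡⟨ cong₂ _*_ (length-permutations (layer t)) (length-arrangements (suc t) m) ⟩
    layerWeight t * prodFrom layerWeight (suc t) m
      ∎
    where
    open ≡-Reasoning
    rest : List (List (Fin n))
    rest = arrangements (suc t) m

  Sorted : List (Fin n) → Set
  Sorted = AllPairs (λ u v → rank u ≤ rank v)

  Sorted-constant : ∀ {t π} → (∀ {v} → v ∈ π → rank v ≡ t) → Sorted π
  Sorted-constant {π = []}    _  = AllPairs.[]
  Sorted-constant {π = u ∷ π} ≡t =
    All.tabulate (λ v∈π → ≤-reflexive (trans (≡t (here refl)) (sym (≡t (there v∈π)))))
    AllPairs.∷ Sorted-constant (≡t ∘ there)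

  record Arranged (t m : ℕ) (zs : List (Fin n)) : Set where
    field
      unique : Unique zs
      above  : ∀ {v} → v ∈ zs → t ≤ rank v
      covers : ∀ v → t ≤ rank v → rank v < t + m → v ∈ zs
      sorted : Sorted zs

  open Arranged

  Arranged-[] : ∀ t → Arranged t 0 []
  Arranged-[] t = record
    { unique = []
    ; above  = λ ()
    ; covers = λ v t≤ <t+0 → contradiction (subst (rank v <_) (+-identityʳ t) <t+0) (≤⇒≯ t≤)
    ; sorted = AllPairs.[]
    }

  Arranged-++ : ∀ {t m π ρ} → π ∈ permutations (layer t) → Arranged (suc t) m ρ → Arranged t (suc m) (π ++ ρ)
  Arranged-++ {t} {m} {π} {ρ} π∈ arr = record
    { unique = Uniqueₚ.++⁺ (Unique-resp-↭ (↭-sym (∈-permutations⇒↭ π∈)) (Unique-layer t)) (unique arr)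
                 λ (v∈π , v∈ρ) → <-irrefl (sym (rank≡ v∈π)) (above arr v∈ρ)
    ; above  = above′
    ; covers = covers′
    ; sorted = AllPairsₚ.++⁺ (Sorted-constant rank≡) (sorted arr)
                 (All.tabulate λ u∈π → All.tabulate λ v∈ρ →
                   ≤-trans (≤-reflexive (rank≡ u∈π)) (<⇒≤ (above arr v∈ρ)))
    }
    where
    rank≡ : ∀ {v} → v ∈ π → rank v ≡ t
    rank≡ = ∈-permutations-layer⁻ π∈
    above′ : ∀ {v} → v ∈ π ++ ρ → t ≤ rank v
    above′ v∈ with ∈-++⁻ π v∈
    ... | inj₁ v∈π = ≤-reflexive (sym (rank≡ v∈π))
    ... | inj₂ v∈ρ = <⇒≤ (above arr v∈ρ)
    covers′ : ∀ v → t ≤ rank v → rank v < t + suc m → v ∈ π ++ ρ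
    covers′ v t≤ <t+1+m with m≤n⇒m<n∨m≡n t≤
    ... | inj₂ t≡ = ∈-++⁺ˡ (∈-resp-↭ (↭-sym (∈-permutations⇒↭ π∈)) (∈-layer⁺ (sym t≡)))
    ... | inj₁ t< = ∈-++⁺ʳ π (covers arr v t< (subst (rank v <_) (+-suc t m) <t+1+m))

  ∈-arrangements⇒Arranged : ∀ t m {zs} → zs ∈ arrangements t m → Arranged t m zs
  ∈-arrangements⇒Arranged t zero    (here refl) = Arranged-[] t
  ∈-arrangements⇒Arranged t (suc m) zs∈ with ∈-concatMap⇒∃ (λ π → map (π ++_) (arrangements (suc t) m)) zs∈
  ... | π , π∈ , zs∈π++ with ∈-map⁻ (π ++_) zs∈π++
  ... | ρ , ρ∈ , refl = Arranged-++ π∈ (∈-arrangements⇒Arranged (suc t) m ρ∈)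

  Unique-arrangements : ∀ t m → Unique (arrangements t m)
  Unique-arrangements t zero    = All.[] ∷ []
  Unique-arrangements t (suc m) =
    Unique-concatMap _ (Unique-permutations (Unique-layer t))
      (λ _ → Uniqueₚ.map⁺ (++-cancelˡ _ _ _) (Unique-arrangements (suc t) m))
      disjoint
    where
    disjoint : ∀ {π π′} → π ∈ permutations (layer t) → π′ ∈ permutations (layer t) → π ≢ π′ →
               Disjoint (map (π ++_) (arrangements (suc t) m)) (map (π′ ++_) (arrangements (suc t) m))
    disjoint {π} {π′} π∈ π′∈ π≢π′ (zs∈ , zs∈′) with ∈-map⁻ (π ++_) zs∈ | ∈-map⁻ (π′ ++_) zs∈′
    ... | _ , _ , refl | _ , _ , eq = π≢π′ (++-injectiveˡ-length π π′ same-length eq)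
      where
      same-length : length π ≡ length π′
      same-length = trans (↭-length (∈-permutations⇒↭ {xs = layer t} π∈))
                          (sym (↭-length (∈-permutations⇒↭ {xs = layer t} π′∈)))

iter-+ : ∀ {A : Set} (f : A → A) a b x → iter f (a + b) x ≡ iter f a (iter f b x)
iter-+ f zero    b x = refl
iter-+ f (suc a) b x = cong f (iter-+ f a b x)

iter-suc : ∀ {A : Set} (f : A → A) m x → iter f (suc m) x ≡ iter f m (f x)
iter-suc f zero    x = refl
iter-suc f (suc m) x = cong f (iter-suc f m x)

iter-fixed : ∀ {A : Set} (f : A → A) {x} → f x ≡ x → ∀ m → iter f m x ≡ x
iter-fixed f fx≡x zero    = refl
iter-fixed f fx≡x (suc m) = trans (cong f (iter-fixed f fx≡x m)) fx≡x

-- The least toℕ i with P i, and k if there is none.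
firstIndex : ∀ {k} {P : Fin k → Set} → (∀ i → Dec (P i)) → ℕ
firstIndex {zero}  P? = 0
firstIndex {suc k} P? with P? zero
... | yes _ = 0
... | no  _ = suc (firstIndex (P? ∘ suc))

firstIndex≤ : ∀ {k} {P : Fin k → Set} (P? : ∀ i → Dec (P i)) → firstIndex P? ≤ k
firstIndex≤ {zero}  P? = z≤n
firstIndex≤ {suc k} P? with P? zero
... | yes _ = z≤n
... | no  _ = s≤s (firstIndex≤ (P? ∘ suc))

firstIndex-minimal : ∀ {k} {P : Fin k → Set} (P? : ∀ i → Dec (P i)) {i} → P i → firstIndex P? ≤ toℕ i
firstIndex-minimal {suc k} P?         Pi with P? zero
... | yes _ = z≤n
firstIndex-minimal {suc k} P? {zero}  Pi | no ¬P0 = contradiction Pi ¬P0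
firstIndex-minimal {suc k} P? {suc i} Pi | no _   = s≤s (firstIndex-minimal (P? ∘ suc) Pi)

firstIndex-satisfied : ∀ {k} {P : Fin k → Set} (P? : ∀ i → Dec (P i)) →
                       firstIndex P? < k → ∃[ i ] toℕ i ≡ firstIndex P? × P i
firstIndex-satisfied {suc k} P? first<k with P? zero
... | yes P0 = zero , refl , P0
... | no  _  with firstIndex-satisfied (P? ∘ suc) (s≤s⁻¹ first<k)
...   | i , i≡first , Pi = suc i , cong suc i≡first , Pi

firstIndex-antitone : ∀ {k} {P Q : Fin k → Set} (P? : ∀ i → Dec (P i)) (Q? : ∀ i → Dec (Q i)) →
                      (∀ i → Q i → P i) → firstIndex P? ≤ firstIndex Q?
firstIndex-antitone {zero}  P? Q? Q⇒P = z≤n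
firstIndex-antitone {suc k} P? Q? Q⇒P with P? zero | Q? zero
... | yes _  | _      = z≤n
... | no ¬P0 | yes Q0 = contradiction (Q⇒P zero Q0) ¬P0
... | no _   | no _   = s≤s (firstIndex-antitone (P? ∘ suc) (Q? ∘ suc) (Q⇒P ∘ suc))

module RootedTree {n} {E : Graph n} {s : Fin n} (T : SpanningTree E s) where

  private
    p : Fin n → Fin n
    p = parent T

  iter-root : ∀ m → iter p m s ≡ s
  iter-root = iter-fixed p (parent-root T)

  iter-beyond : ∀ {v r m} → iter p r v ≡ s → r ≤ m → iter p m v ≡ s
  iter-beyond {v} {r} {m} reaches r≤m = begin
    iter p m v                  ≡⟨ cong (λ j → iter p j v) (sym (m∸n+n≡m r≤m)) ⟩
    iter p (m ∸ r + r) v        ≡⟨ iter-+ p (m ∸ r) r v ⟩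
    iter p (m ∸ r) (iter p r v) ≡⟨ cong (iter p (m ∸ r)) reaches ⟩
    iter p (m ∸ r) s            ≡⟨ iter-root (m ∸ r) ⟩
    s                           ∎
    where open ≡-Reasoning

  private
    ReachesRoot : Fin n → ℕ → Set
    ReachesRoot v j = iter p j v ≡ s

    steps : Fin n → ℕ
    steps v = proj₁ (rooted T v)

  depth : Fin n → ℕ
  depth v = firstIndex {suc (steps v)} (λ j → iter p (toℕ j) v Finₚ.≟ s)

  depth≤steps : ∀ v → depth v ≤ steps v
  depth≤steps v = subst (depth v ≤_) (Finₚ.toℕ-fromℕ (steps v))
    (firstIndex-minimal _ (subst (ReachesRoot v) (sym (Finₚ.toℕ-fromℕ (steps v))) (proj₂ (rooted T v))))

  iter-depth : ∀ v → iter p (depth v) v ≡ s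
  iter-depth v with firstIndex-satisfied (λ j → iter p (toℕ j) v Finₚ.≟ s) (s≤s (depth≤steps v))
  ... | j , j≡depth , reaches = subst (ReachesRoot v) j≡depth reaches

  depth-minimal : ∀ {v m} → iter p m v ≡ s → depth v ≤ m
  depth-minimal {v} {m} reaches with m ≤? steps v
  ... | yes m≤steps = subst (depth v ≤_) (Finₚ.toℕ-fromℕ< (s≤s m≤steps))
    (firstIndex-minimal _ (subst (ReachesRoot v) (sym (Finₚ.toℕ-fromℕ< (s≤s m≤steps))) reaches))
  ... | no m≰steps = ≤-trans (depth≤steps v) (<⇒≤ (≰⇒> m≰steps))

  depth-parent< : ∀ {v} → v ≢ s → depth (p v) < depth v
  depth-parent< {v} v≢s with depth v | iter-depth v
  ... | zero  | v≡s     = contradiction v≡s v≢s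
  ... | suc d | reaches = s≤s (depth-minimal (trans (sym (iter-suc p d v)) reaches))

  depth-parent≤ : ∀ v → depth (p v) ≤ depth v
  -- A case split through a helper rather than `with`, which would also abstract v ≟ s inside depth v.
  depth-parent≤ v = by-cases (v Finₚ.≟ s)
    where
    by-cases : Dec (v ≡ s) → depth (p v) ≤ depth v
    by-cases (yes refl) = ≤-reflexive (cong depth (parent-root T))
    by-cases (no  v≢s)  = <⇒≤ (depth-parent< v≢s)

  Ancestor⇒depth≤ : ∀ {u v} → Ancestor T u v → depth u ≤ depth v
  Ancestor⇒depth≤         (zero  , refl) = ≤-refl
  Ancestor⇒depth≤ {v = v} (suc m , refl) = ≤-trans (depth-parent≤ (iter p m v)) (Ancestor⇒depth≤ (m , refl))

  ProperAncestor⇒depth< : ∀ {u v} → ProperAncestor T u v → depth u < depth v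
  ProperAncestor⇒depth<         (u≢v , zero  , refl) = contradiction refl u≢v
  ProperAncestor⇒depth< {v = v} (u≢v , suc m , refl) = by-cases (v Finₚ.≟ s)
    where
    by-cases : Dec (v ≡ s) → depth (iter p (suc m) v) < depth v
    by-cases (yes refl) = contradiction (iter-root (suc m)) u≢v
    by-cases (no  v≢s)  = ≤-<-trans (Ancestor⇒depth≤ (m , sym (iter-suc p m v))) (depth-parent< v≢s)

  Ancestor-trans : ∀ {u v w} → Ancestor T u v → Ancestor T v w → Ancestor T u w
  Ancestor-trans {w = w} (m , refl) (j , refl) = m + j , iter-+ p m j w

  -- Beyond the depth of v every iterate is the root, so it suffices to search the first depth v + 1 iterates.
  ancestor? : ∀ u v → Dec (Ancestor T u v)
  ancestor? u v = Dec.map′ (λ (j , _ , reaches) → j , reaches) bounded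
                           (anyUpTo? (λ j → iter p j v Finₚ.≟ u) (suc (depth v)))
    where
    bounded : Ancestor T u v → ∃[ j ] j < suc (depth v) × iter p j v ≡ u
    bounded (m , reaches) with m ≤? depth v
    ... | yes m≤depth = m , s≤s m≤depth , reaches
    ... | no  m≰depth = depth v , ≤-refl ,
      trans (iter-depth v) (trans (sym (iter-beyond (iter-depth v) (<⇒≤ (≰⇒> m≰depth)))) reaches)

!-mono-≤ : ∀ {m n} → m ≤ n → m ! ≤ n !
!-mono-≤ {n = n} m≤n = ∣⇒≤ {{n !≢0}} (m≤n⇒m!∣n! m≤n)

module _ {n} {E : Graph n} {s : Fin n} (T : SpanningTree E s) (rank : Fin n → ℕ)
         (rank-strict : ∀ {u v} → ProperAncestor T u v → rank u < rank v) {R} (rank< : ∀ v → rank v < R) where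

  open Layers rank
  open Arranged

  Arranged⇒IsLinearization : ∀ {zs} → Arranged 0 R zs → IsLinearization T zs
  Arranged⇒IsLinearization arr =
    (unique arr , λ v → covers arr v z≤n (rank< v)) ,
    λ i j i<j anc → <⇒≱ (rank-strict anc) (AllPairs-lookup (sorted arr) i<j)

  prodFrom-layerWeight≤Lin : ∀ {m} → LinT≡ T m → prodFrom layerWeight 0 R ≤ m
  prodFrom-layerWeight≤Lin (L , _ , _ , complete , refl) = begin
    prodFrom layerWeight 0 R  ≡⟨ sym (length-arrangements 0 R) ⟩
    length (arrangements 0 R) ≤⟨ Unique⇒length≤ (Unique-arrangements 0 R) arrangement∈L ⟩
    length L                  ∎
    where
    open ≤-Reasoning
    arrangement∈L : arrangements 0 R ⊆ L
    arrangement∈L zs∈ = complete _ (Arranged⇒IsLinearization (∈-arrangements⇒Arranged 0 R zs∈))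

module BarrierRank {n} {E : Graph n} {s : Fin n} (T : SpanningTree E s)
                   {k} (B : Fin k → Subset n) (barriers : IsBarrierSequence T k B) where

  open RootedTree T

  private
    antichain : ∀ i → IsBarrier T (B i)
    antichain = proj₁ barriers
    ordered : ∀ i j → i <ᶠ j → Precedes T (B i) (B j)
    ordered = proj₂ (proj₂ barriers)

  Reaches : Fin n → Fin k → Set
  Reaches v i = ∃[ w ] w ∈ₛ B i × Ancestor T v w

  reaches? : ∀ v i → Dec (Reaches v i)
  reaches? v i = Finₚ.any? (λ w → (w ∈? B i) ×-dec ancestor? v w)

  level : Fin n → ℕ
  level v = firstIndex (reaches? v)

  InBarrier : Fin n → Set
  InBarrier v = ∃[ i ] v ∈ₛ B i

  maxDepth : ℕ
  maxDepth = max 0 (map depth (allFin n))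

  depth≤maxDepth : ∀ v → depth v ≤ maxDepth
  depth≤maxDepth v = All.lookup (xs≤max 0 (map depth (allFin n))) (∈-map⁺ depth (∈-allFin v))

  -- rank is lexicographic in (level, offset). Barrier vertices get an offset above every depth,
  -- since their ancestors on the same level must come first.
  offset : Fin n → ℕ
  offset v = if does (Finₚ.any? (λ i → v ∈? B i)) then suc maxDepth else depth v

  width : ℕ
  width = suc (suc maxDepth)

  rank : Fin n → ℕ
  rank v = level v * width + offset v

  level-antitone : ∀ {u v} → Ancestor T u v → level u ≤ level v
  level-antitone u⇝v = firstIndex-antitone (reaches? _) (reaches? _)
    (λ i (w , w∈B , v⇝w) → w , w∈B , Ancestor-trans u⇝v v⇝w)

  level-barrier : ∀ {v i} → v ∈ₛ B i → level v ≡ toℕ i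
  level-barrier {v} {i} v∈B with m≤n⇒m<n∨m≡n (firstIndex-minimal (reaches? v) (v , v∈B , 0 , refl))
  ... | inj₂ level≡i = level≡i
  ... | inj₁ level<i with firstIndex-satisfied (reaches? v) (<-trans level<i (Finₚ.toℕ<n i))
  ...   | j , j≡level , (w , w∈B , v⇝w) =
    contradiction v⇝w (ordered j i (subst (_< toℕ i) (sym j≡level) level<i) v w v∈B w∈B)

  offset-barrier : ∀ {v} → InBarrier v → offset v ≡ suc maxDepth
  offset-barrier {v} v∈B with Finₚ.any? (λ i → v ∈? B i)
  ... | yes _   = refl
  ... | no  v∉B = contradiction v∈B v∉B

  offset-nonbarrier : ∀ {v} → ¬ InBarrier v → offset v ≡ depth v
  offset-nonbarrier {v} v∉B with Finₚ.any? (λ i → v ∈? B i)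
  ... | yes v∈B = contradiction v∈B v∉B
  ... | no  _   = refl

  offset<width : ∀ v → offset v < width
  offset<width v with Finₚ.any? (λ i → v ∈? B i)
  ... | yes _ = ≤-refl
  ... | no  _ = s≤s (m≤n⇒m≤1+n (depth≤maxDepth v))

  depth<offset : ∀ {u v} → ProperAncestor T u v → depth u < offset v
  depth<offset {u} {v} u⇝v with Finₚ.any? (λ i → v ∈? B i)
  ... | yes _ = s≤s (depth≤maxDepth u)
  ... | no  _ = ProperAncestor⇒depth< u⇝v

  level≡⇒Reaches : ∀ {v i} → level v ≡ toℕ i → Reaches v i
  level≡⇒Reaches {v} {i} level≡i
    with firstIndex-satisfied (reaches? v) (subst (_< k) (sym level≡i) (Finₚ.toℕ<n i))
  ... | j , j≡level , reaches with Finₚ.toℕ-injective (trans j≡level level≡i)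
  ...   | refl = reaches

  -- u lies above the first barrier reached from v, so by the antichain property it lies in no barrier.
  sameLevel⇒¬InBarrier : ∀ {u v} → ProperAncestor T u v → level u ≡ level v → ¬ InBarrier u
  sameLevel⇒¬InBarrier {u} {v} (u≢v , u⇝v) level≡ (i , u∈B)
    with level≡⇒Reaches (trans (sym level≡) (level-barrier u∈B))
  ... | w , w∈B , v⇝w with u Finₚ.≟ w
  ...   | yes refl = <⇒≱ (ProperAncestor⇒depth< (u≢v , u⇝v)) (Ancestor⇒depth≤ v⇝w)
  ...   | no  u≢w  = antichain i u w u∈B w∈B u≢w (Ancestor-trans u⇝v v⇝w)

  rank-strict : ∀ {u v} → ProperAncestor T u v → rank u < rank v
  rank-strict {u} {v} u⇝v with m≤n⇒m<n∨m≡n (level-antitone (proj₂ u⇝v))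
  ... | inj₁ level< = begin-strict
    level u * width + offset u  <⟨ +-monoʳ-< (level u * width) (offset<width u) ⟩
    level u * width + width     ≡⟨ +-comm (level u * width) width ⟩
    suc (level u) * width       ≤⟨ *-monoˡ-≤ width level< ⟩
    level v * width             ≤⟨ m≤m+n (level v * width) (offset v) ⟩
    level v * width + offset v  ∎
    where open ≤-Reasoning
  ... | inj₂ level≡ = begin-strict
    level u * width + offset u  ≡⟨ cong₂ _+_ (cong (_* width) level≡)
                                             (offset-nonbarrier (sameLevel⇒¬InBarrier u⇝v level≡)) ⟩
    level v * width + depth u   <⟨ +-monoʳ-< (level v * width) (depth<offset u⇝v) ⟩
    level v * width + offset v  ∎
    where open ≤-Reasoning

  rank-barrier : ∀ {v} i → v ∈ₛ B i → rank v ≡ toℕ i * width + suc maxDepth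
  rank-barrier i v∈B = cong₂ _+_ (cong (_* width) (level-barrier v∈B)) (offset-barrier (i , v∈B))

  rank< : ∀ v → rank v < k * width + width
  rank< v = +-mono-≤-< (*-monoˡ-≤ width (firstIndex≤ (reaches? v))) (offset<width v)

  prodFin-!≤prodFrom-layerWeight :
    prodFin k (λ i → ∣ B i ∣ !) ≤ prodFrom (Layers.layerWeight rank) 0 (k * width + width)
  prodFin-!≤prodFrom-layerWeight = ≤-trans
    (prodFin≤prodFrom layerWeight (λ t → length (layer t) !≢0) ≤-refl k 0 (λ i → ∣ B i ∣ !)
      (λ i → !-mono-≤ (∣p∣≤length-layer (B i) (rank-barrier i))))
    (prodFrom-extend layerWeight (λ t → length (layer t) !≢0) 0 (k * width) width)
    where open Layers rank

LinT≤LinG : ∀ {n} {E : Graph n} {s : Fin n} (T : SpanningTree E s) {mT mG} →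
            LinT≡ T mT → LinG≡ E s mG → mT ≤ mG
LinT≤LinG T (_ , !LT , linearT , _ , refl) (_ , _ , _ , completeG , refl) =
  Unique⇒length≤ !LT (λ {zs} zs∈ → completeG zs (T , linearT zs zs∈))

prodFin-!≤Lin : ∀ {n} {E : Graph n} {s : Fin n} (T : SpanningTree E s) {k} (B : Fin k → Subset n) →
                IsBarrierSequence T k B → ∀ {m} → LinT≡ T m → prodFin k (λ i → ∣ B i ∣ !) ≤ m
prodFin-!≤Lin T B barriers linT =
  ≤-trans prodFin-!≤prodFrom-layerWeight (prodFrom-layerWeight≤Lin T rank rank-strict rank< linT)
  where open BarrierRank T B barriers

barrierWeight≤Lin² : ∀ {n} {E : Graph n} {s : Fin n} (T : SpanningTree E s) {k} (B : Fin k → Subset n) →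
                     IsBarrierSequence T k B → ∀ {m} → LinT≡ T m → barrierWeight k B ≤ m ^ 2
barrierWeight≤Lin² T {k} B barriers {m} linT = begin
  prodFin k (λ i → ∣ B i ∣ ^ ∣ B i ∣)       ≤⟨ prodFin-mono-≤ k (λ i → ^-self≤!*! ∣ B i ∣) ⟩
  prodFin k (λ i → ∣ B i ∣ ! * ∣ B i ∣ !)   ≡⟨ prodFin-square k (λ i → ∣ B i ∣ !) ⟩
  prodFin k (λ i → ∣ B i ∣ !) * prodFin k (λ i → ∣ B i ∣ !) ≤⟨ *-mono-≤ ∏!≤m ∏!≤m ⟩
  m * m                                     ≡⟨ cong (m *_) (sym (*-identityʳ m)) ⟩
  m ^ 2                                     ∎
  where
  open ≤-Reasoning
  ∏!≤m : prodFin k (λ i → ∣ B i ∣ !) ≤ m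
  ∏!≤m = prodFin-!≤Lin T B barriers linT

mainTheorem9 : ∃[ d ] (∀ (n : ℕ) (E : Graph n) (s : Fin n) → AllReachable E s →
                 (T : SpanningTree E s) (k : ℕ) (B : Fin k → Subset n) →
                 IsBarrierSequence T k B →
                 (mT mG : ℕ) → LinT≡ T mT → LinG≡ E s mG →
                 mT ≤ mG × barrierWeight k B ≤ mT ^ d)
mainTheorem9 = 2 , λ n E s _ T k B barriers mT mG linT linG →
  LinT≤LinG T linT linG , barrierWeight≤Lin² T B barriers linT
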